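{- Let $R$ be an integral domain and let $L$ be a finitely generated Lie $R$-algebra. Let $P(\bar f_L)$ be the maximal ring of scalars of the bilinear map $\bar f_L\colon L/\mathrm{Ann}(L)\times L/\mathrm{Ann}(L)\to L^2$, $(x+\mathrm{Ann}(L),y+\mathrm{Ann}(L))\mapsto xy$. Then the following are 0-interpretable in $L$, viewed as a ring in the language $\{+,\cdot,0\}$: - the ring $P(\bar f_L)$; - its action on $L/\mathrm{Ann}(L)$; - its action on $L^2$. This interpretation is uniform in the size of a finite generating set of $L$.
   Context: $L^2$ is the $R$-submodule of $L$ generated by all products $xy$, and $\mathrm{Ann}(L)=\{x\in L\mid xL=0\}$. Maximal ring of scalars. Let $f\colon M_1\times M_2\to N$ be a bilinear map that is: - non-degenerate: no nonzero $x\in M_1$ has $f(x,M_2)=0$, and no nonzero $y\in M_2$ has $f(M_1,y)=0$; - onto: $f(M_1,M_2)$ generates $N$ as an abelian group. The maximal ring of scalars $P(f)$ is the set of triples $(\alpha_1,\alpha_2,\sigma)\in \mathrm{End}(M_1)\times\mathrm{End}(M_2)\times\mathrm{End}(N)$, with endomorphisms taken of abelian groups, such that $f(\alpha_1x,y)=f(x,\alpha_2y)=\sigma f(x,y)$ for all $x\in M_1$ and $y\in M_2$. It is a commutative unital subring of the product ring. It acts faithfully on $M_1,M_2,N$ through the respective coordinates, and every commutative unital ring acting faithfully on $M_1,M_2,N$ so that $f$ is bilinear over it embeds into $P(f)$ compatibly with the actions. 0-interpretability. A structure $\mathcal M$ is 0-interpretable in $L$ if the following exist, all given by first-order formulas without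 parameters in the ring language of $L$: - a definable subset $D\subseteq L^n$; - a definable equivalence relation $\sim$ on $D$; - definable relations on $D$ that are invariant under $\sim$, such that the resulting structure on $D/\sim$ is isomorphic to $\mathcal M$. A structure with several sorts, such as a ring together with modules and its actions on them, is interpreted sort by sort. Uniformity in a parameter means that the same formulas work for all algebras for which that parameter takes a given value. -}

module Defs where

open import Level using (Level; _⊔_; Lift) renaming (suc to lsuc)
open import Data.Nat using (ℕ; suc; _+_)
open import Data.Fin using (Fin)
open import Data.Product using (Σ; _×_; _,_; proj₁)
open import Data.Sum using (_⊎_)
open import Data.Empty using (⊥)
open import Data.Vec.Functional using (_∷_; _++_)
open import Relation.Nullary using (¬_)
open import Function.Bundles using (_⇔_)
open import Algebra.Bundles using (CommutativeRing)
open import Algebra.Module.Bundles using (Module)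

private
  variable
    r ℓr m ℓm : Level

record IsIntegralDomain (R : CommutativeRing r ℓr) : Set (r ⊔ ℓr) where
  open CommutativeRing R
  field
    1≉0 : ¬ (1# ≈ 0#)
    noZeroDivisors : ∀ a b → a * b ≈ 0# → a ≈ 0# ⊎ b ≈ 0#

record LieAlgebra (R : CommutativeRing r ℓr) m ℓm : Set (r ⊔ ℓr ⊔ lsuc (m ⊔ ℓm)) where
  open CommutativeRing R using (Carrier)
  field
    module′ : Module R m ℓm
  open Module module′ public
  infixl 7 _·_
  field
    _·_     : Carrierᴹ → Carrierᴹ → Carrierᴹ
    ·-cong  : ∀ {x x′ y y′} → x ≈ᴹ x′ → y ≈ᴹ y′ → x · y ≈ᴹ x′ · y′
    ·-distribʳ : ∀ x y z → (x +ᴹ y) · z ≈ᴹ x · z +ᴹ y · z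
    ·-distribˡ : ∀ x y z → x · (y +ᴹ z) ≈ᴹ x · y +ᴹ x · z
    ·-*ₗʳ  : ∀ (a : Carrier) x y → (a *ₗ x) · y ≈ᴹ a *ₗ (x · y)
    ·-*ₗˡ  : ∀ (a : Carrier) x y → x · (a *ₗ y) ≈ᴹ a *ₗ (x · y)
    alternating : ∀ x → x · x ≈ᴹ 0ᴹ
    jacobi : ∀ x y z → x · (y · z) +ᴹ y · (z · x) +ᴹ z · (x · y) ≈ᴹ 0ᴹ

infixl 6 _⊕_
infixl 7 _⊗_
data Term (k : ℕ) : Set where
  var  : Fin k → Term k
  zer  : Term k
  _⊕_  : Term k → Term k → Term k
  _⊗_  : Term k → Term k → Term k

infix 4 _≐_
data Formula (k : ℕ) : Set where
  _≐_  : Term k → Term k → Formula k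
  ⊥f   : Formula k
  _∧f_ _∨f_ _⇒f_ : Formula k → Formula k → Formula k
  ∀f ∃f : Formula (suc k) → Formula k

module _ {R : CommutativeRing r ℓr} (L : LieAlgebra R m ℓm) where
  open CommutativeRing R using (Carrier)
  open LieAlgebra L

  eval : ∀ {k} → Term k → (Fin k → Carrierᴹ) → Carrierᴹ
  eval (var i) ρ = ρ i
  eval zer ρ = 0ᴹ
  eval (s ⊕ t) ρ = eval s ρ +ᴹ eval t ρ
  eval (s ⊗ t) ρ = eval s ρ · eval t ρ

  Sat : ∀ {k} → Formula k → (Fin k → Carrierᴹ) → Set (m ⊔ ℓm)
  Sat (s ≐ t) ρ = Lift m (eval s ρ ≈ᴹ eval t ρ)
  Sat ⊥f ρ = Lift (m ⊔ ℓm) ⊥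
  Sat (φ ∧f ψ) ρ = Sat φ ρ × Sat ψ ρ
  Sat (φ ∨f ψ) ρ = Sat φ ρ ⊎ Sat ψ ρ
  Sat (φ ⇒f ψ) ρ = Sat φ ρ → Sat ψ ρ
  Sat (∀f φ) ρ = ∀ x → Sat φ (x ∷ ρ)
  Sat (∃f φ) ρ = Σ Carrierᴹ λ x → Sat φ (x ∷ ρ)

  data InSubalg {n : ℕ} (g : Fin n → Carrierᴹ) : Carrierᴹ → Set (r ⊔ m ⊔ ℓm) where
    gen  : ∀ i → InSubalg g (g i)
    zero : InSubalg g 0ᴹ
    add  : ∀ {x y} → InSubalg g x → InSubalg g y → InSubalg g (x +ᴹ y)
    smul : ∀ (a : Carrier) {x} → InSubalg g x → InSubalg g (a *ₗ x)
    brk  : ∀ {x y} → InSubalg g x → InSubalg g y → InSubalg g (x · y)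
    resp : ∀ {x y} → x ≈ᴹ y → InSubalg g x → InSubalg g y

  Generates : ∀ {n} → (Fin n → Carrierᴹ) → Set (r ⊔ m ⊔ ℓm)
  Generates g = ∀ x → InSubalg g x

  -- L/Ann(L): L with equality x ~ y iff x - y ∈ Ann(L) = {x | xL = 0}.

  InAnn : Carrierᴹ → Set (m ⊔ ℓm)
  InAnn x = ∀ z → x · z ≈ᴹ 0ᴹ

  infix 4 _~_
  _~_ : Carrierᴹ → Carrierᴹ → Set (m ⊔ ℓm)
  x ~ y = InAnn (x +ᴹ (-ᴹ y))

  data InSq : Carrierᴹ → Set (r ⊔ m ⊔ ℓm) where
    prod : ∀ x y → InSq (x · y)
    zero : InSq 0ᴹ
    add  : ∀ {x y} → InSq x → InSq y → InSq (x +ᴹ y)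
    smul : ∀ (a : Carrier) {x} → InSq x → InSq (a *ₗ x)
    resp : ∀ {x y} → x ≈ᴹ y → InSq x → InSq y

  Sq : Set (r ⊔ m ⊔ ℓm)
  Sq = Σ Carrierᴹ InSq

  infix 4 _≈Sq_
  _≈Sq_ : Sq → Sq → Set ℓm
  u ≈Sq v = proj₁ u ≈ᴹ proj₁ v

  infixl 6 _+Sq_
  _+Sq_ : Sq → Sq → Sq
  (x , p) +Sq (y , q) = (x +ᴹ y , add p q)

  0Sq : Sq
  0Sq = (0ᴹ , zero)

  -- The maximal ring of scalars P(f̄_L) of
  --   f̄_L : L/Ann(L) × L/Ann(L) → L²,  (x + Ann, y + Ann) ↦ xy.

  record Scalar : Set (r ⊔ m ⊔ ℓm) where
    field
      α₁ α₂ : Carrierᴹ → Carrierᴹ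
      σ     : Sq → Sq
      α₁-cong : ∀ {x y} → x ~ y → α₁ x ~ α₁ y
      α₁-add  : ∀ x y → α₁ (x +ᴹ y) ~ α₁ x +ᴹ α₁ y
      α₂-cong : ∀ {x y} → x ~ y → α₂ x ~ α₂ y
      α₂-add  : ∀ x y → α₂ (x +ᴹ y) ~ α₂ x +ᴹ α₂ y
      σ-cong  : ∀ {u v} → u ≈Sq v → σ u ≈Sq σ v
      σ-add   : ∀ u v → σ (u +Sq v) ≈Sq σ u +Sq σ v
      balanced₁ : ∀ x y → α₁ x · y ≈ᴹ x · α₂ y
      balanced₂ : ∀ x y → x · α₂ y ≈ᴹ proj₁ (σ (x · y , prod x y))
  open Scalar public

  infix 4 _≈P_
  _≈P_ : Scalar → Scalar → Set (r ⊔ m ⊔ ℓm)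
  p ≈P q = (∀ x → α₁ p x ~ α₁ q x) × (∀ x → α₂ p x ~ α₂ q x)
           × (∀ u → σ p u ≈Sq σ q u)

  IsZeroP : Scalar → Set (r ⊔ m ⊔ ℓm)
  IsZeroP p = (∀ x → α₁ p x ~ 0ᴹ) × (∀ x → α₂ p x ~ 0ᴹ) × (∀ u → σ p u ≈Sq 0Sq)

  IsOneP : Scalar → Set (r ⊔ m ⊔ ℓm)
  IsOneP p = (∀ x → α₁ p x ~ x) × (∀ x → α₂ p x ~ x) × (∀ u → σ p u ≈Sq u)

  IsSumP : Scalar → Scalar → Scalar → Set (r ⊔ m ⊔ ℓm)
  IsSumP p q s = (∀ x → α₁ s x ~ α₁ p x +ᴹ α₁ q x) × (∀ x → α₂ s x ~ α₂ p x +ᴹ α₂ q x)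
                 × (∀ u → σ s u ≈Sq σ p u +Sq σ q u)

  IsProdP : Scalar → Scalar → Scalar → Set (r ⊔ m ⊔ ℓm)
  IsProdP p q s = (∀ x → α₁ s x ~ α₁ p (α₁ q x)) × (∀ x → α₂ s x ~ α₂ p (α₂ q x))
                  × (∀ u → σ s u ≈Sq σ p (σ q u))

-- A parameter-free interpretation of the three-sorted structure
--   (P(f̄_L); L/Ann(L) as P-module; L² as P-module)
-- consists of formulas (independent of L) ...

record Formulas : Set where
  field
    nP    : ℕ
    DomP  : Formula nP
    EqP   : Formula (nP + nP)
    ZeroP OneP : Formula nP
    AddP MulP  : Formula (nP + (nP + nP))
    nM    : ℕ
    DomM  : Formula nM
    EqM   : Formula (nM + nM)
    ZeroM : Formula nM
    AddM  : Formula (nM + (nM + nM))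
    ActM  : Formula (nP + (nM + nM))
    nN    : ℕ
    DomN  : Formula nN
    EqN   : Formula (nN + nN)
    ZeroN : Formula nN
    AddN  : Formula (nN + (nN + nN))
    ActN  : Formula (nP + (nN + nN))

-- ... together with, for the given L, surjective coordinate maps π from
-- the defined sets onto the sorts, such that the defined equivalence
-- relations are the kernels of the π and each defined relation is the
-- preimage of the corresponding relation of the structure.  This says
-- exactly that (Dom/Eq, with the induced relations) ≅ the structure.

record Interprets (F : Formulas) {R : CommutativeRing r ℓr} (L : LieAlgebra R m ℓm)
                  : Set (r ⊔ m ⊔ ℓm) where
  open Formulas F
  open LieAlgebra L using (Carrierᴹ; _+ᴹ_; 0ᴹ)
  Tup : ℕ → Set m
  Tup k = Fin k → Carrierᴹ
  field
    πP : (a : Tup nP) → Sat L DomP a → Scalar L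
    πM : (a : Tup nM) → Sat L DomM a → Carrierᴹ
    πN : (a : Tup nN) → Sat L DomN a → Sq L

    πP-onto : ∀ p → Σ (Tup nP) λ a → Σ (Sat L DomP a) λ d → _≈P_ L (πP a d) p
    πM-onto : ∀ x → Σ (Tup nM) λ a → Σ (Sat L DomM a) λ d → _~_ L (πM a d) x
    πN-onto : ∀ u → Σ (Tup nN) λ a → Σ (Sat L DomN a) λ d → _≈Sq_ L (πN a d) u

    EqP-ker : ∀ a b (da : Sat L DomP a) (db : Sat L DomP b) →
              Sat L EqP (a ++ b) ⇔ _≈P_ L (πP a da) (πP b db)
    ZeroP-ok : ∀ a (da : Sat L DomP a) → Sat L ZeroP a ⇔ IsZeroP L (πP a da)
    OneP-ok  : ∀ a (da : Sat L DomP a) → Sat L OneP a ⇔ IsOneP L (πP a da)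
    AddP-ok  : ∀ a b c (da : Sat L DomP a) (db : Sat L DomP b) (dc : Sat L DomP c) →
               Sat L AddP (a ++ (b ++ c)) ⇔ IsSumP L (πP a da) (πP b db) (πP c dc)
    MulP-ok  : ∀ a b c (da : Sat L DomP a) (db : Sat L DomP b) (dc : Sat L DomP c) →
               Sat L MulP (a ++ (b ++ c)) ⇔ IsProdP L (πP a da) (πP b db) (πP c dc)

    EqM-ker : ∀ a b (da : Sat L DomM a) (db : Sat L DomM b) →
              Sat L EqM (a ++ b) ⇔ _~_ L (πM a da) (πM b db)
    ZeroM-ok : ∀ a (da : Sat L DomM a) → Sat L ZeroM a ⇔ _~_ L (πM a da) 0ᴹ
    AddM-ok  : ∀ a b c (da : Sat L DomM a) (db : Sat L DomM b) (dc : Sat L DomM c) →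
               Sat L AddM (a ++ (b ++ c)) ⇔ _~_ L (πM a da +ᴹ πM b db) (πM c dc)
    ActM-ok  : ∀ p a b (dp : Sat L DomP p) (da : Sat L DomM a) (db : Sat L DomM b) →
               Sat L ActM (p ++ (a ++ b)) ⇔ _~_ L (α₁ (πP p dp) (πM a da)) (πM b db)

    EqN-ker : ∀ a b (da : Sat L DomN a) (db : Sat L DomN b) →
              Sat L EqN (a ++ b) ⇔ _≈Sq_ L (πN a da) (πN b db)
    ZeroN-ok : ∀ a (da : Sat L DomN a) → Sat L ZeroN a ⇔ _≈Sq_ L (πN a da) (0Sq L)
    AddN-ok  : ∀ a b c (da : Sat L DomN a) (db : Sat L DomN b) (dc : Sat L DomN c) →
               Sat L AddN (a ++ (b ++ c)) ⇔ _≈Sq_ L (_+Sq_ L (πN a da) (πN b db)) (πN c dc)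
    ActN-ok  : ∀ p a b (dp : Sat L DomP p) (da : Sat L DomN a) (db : Sat L DomN b) →
               Sat L ActN (p ++ (a ++ b)) ⇔ _≈Sq_ L (σ (πP p dp) (πN a da)) (πN b db)

module Submission where

-- An element (α₁, α₂, σ) of P(f̄_L) is determined by the values α₂(gᵢ) on the
-- generators: modulo Ann(L), α₁ x is the unique s with s·gᵢ = x·α₂(gᵢ) for all i,
-- and σ is forced on L² = Σᵢ gᵢL by σ(Σ gᵢzᵢ) = Σ gᵢ α₂(zᵢ).  So P(f̄_L) is
-- interpreted on pairs of n-tuples (E, W) satisfying a first-order condition:
-- only Ann(L) annihilates E, L² = Σ EᵢL, every x has such an "image" s, and the
-- resulting maps are balanced and well defined on L².  Each (g, α₂ ∘ g) is such a
-- code and every code decodes to an element of P(f̄_L); equality, the ring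
-- operations and the actions are read off from images.  L/Ann(L) is L modulo
-- x ~ y ⟺ ∀z. xz = yz, and L² is interpreted by pairs (X, Y) ↦ Σ XᵢYᵢ.  Only
-- the number n of generators enters the formulas.

open import Defs
open import Level using (Level; _⊔_; Lift; lift; lower)
open import Data.Nat using (ℕ; zero; suc; _+_)
open import Data.Fin using (Fin; zero; suc; _↑ˡ_; _↑ʳ_; splitAt)
open import Data.Fin.Properties using (∀-cons-⇔)
open import Data.Fin.Patterns using (0F; 1F; 2F; 3F)
open import Data.Product using (Σ; _×_; _,_; proj₁; proj₂)
open import Data.Product.Function.NonDependent.Propositional using (_×-⇔_)
open import Data.Product.Function.Dependent.Propositional using (Σ-⇔)
open import Data.Sum using (inj₁; inj₂)
open import Data.Vec.Functional using (_∷_; _++_)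
open import Data.Vec.Functional.Properties using (∷-cong; lookup-++ˡ; lookup-++ʳ)
open import Function using (_∘_)
open import Function.Bundles using (_⇔_; mk⇔; Equivalence)
open import Function.Construct.Composition using (_⇔-∘_)
open import Function.Construct.Identity using (↠-id)
open import Function.Related.TypeIsomorphisms using (→-cong-⇔)
open import Relation.Binary.PropositionalEquality
  using (_≡_; _≗_; refl; sym; trans; cong; cong₂; subst₂)
open import Algebra.Bundles using (CommutativeRing)
open import Axiom.ExcludedMiddle using (ExcludedMiddle)

∀-⇔ : ∀ {a b c} {X : Set a} {A : X → Set b} {B : X → Set c} →
      (∀ x → A x ⇔ B x) → (∀ x → A x) ⇔ (∀ x → B x)
∀-⇔ A⇔B = mk⇔ (λ f x → Equivalence.to (A⇔B x) (f x)) (λ f x → Equivalence.from (A⇔B x) (f x))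

∃-⇔ : ∀ {a b c} {X : Set a} {A : X → Set b} {B : X → Set c} →
      (∀ x → A x ⇔ B x) → Σ X A ⇔ Σ X B
∃-⇔ A⇔B = Σ-⇔ (↠-id _) (A⇔B _)

⊤f : ∀ {k} → Formula k
⊤f = ⊥f ⇒f ⊥f

⋀ : ∀ {n k} → (Fin n → Formula k) → Formula k
⋀ {zero}  φ = ⊤f
⋀ {suc n} φ = φ zero ∧f ⋀ (φ ∘ suc)

∑ᵗ : ∀ {n k} → (Fin n → Term k) → Term k
∑ᵗ {zero}  t = zer
∑ᵗ {suc n} t = t zero ⊕ ∑ᵗ (t ∘ suc)

∀ⁿ : ∀ {n k} → Formula (n + k) → Formula k
∀ⁿ {zero}  φ = φ
∀ⁿ {suc n} φ = ∀ⁿ {n} (∀f φ)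

∃ⁿ : ∀ {n k} → Formula (n + k) → Formula k
∃ⁿ {zero}  φ = φ
∃ⁿ {suc n} φ = ∃ⁿ {n} (∃f φ)

module Semantics {r ℓr m ℓm} {R : CommutativeRing r ℓr} (L : LieAlgebra R m ℓm) where
  open LieAlgebra L
  open import Algebra.Properties.CommutativeMonoid.Sum +ᴹ-commutativeMonoid using (sum)

  Env : ℕ → Set m
  Env k = Fin k → Carrierᴹ

  eval-∑ᵗ : ∀ {n k} (t : Fin n → Term k) ρ → eval L (∑ᵗ t) ρ ≡ sum (λ i → eval L (t i) ρ)
  eval-∑ᵗ {zero}  t ρ = refl
  eval-∑ᵗ {suc n} t ρ = cong (eval L (t zero) ρ +ᴹ_) (eval-∑ᵗ (t ∘ suc) ρ)

  eval-cong : ∀ {k} (t : Term k) {ρ ρ′ : Env k} → ρ ≗ ρ′ → eval L t ρ ≡ eval L t ρ′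
  eval-cong (var i) eq = eq i
  eval-cong zer     eq = refl
  eval-cong (s ⊕ t) eq = cong₂ _+ᴹ_ (eval-cong s eq) (eval-cong t eq)
  eval-cong (s ⊗ t) eq = cong₂ _·_ (eval-cong s eq) (eval-cong t eq)

  Sat-cong : ∀ {k} (φ : Formula k) {ρ ρ′ : Env k} → ρ ≗ ρ′ → Sat L φ ρ → Sat L φ ρ′
  Sat-cong (s ≐ t) eq (lift p) = lift (subst₂ _≈ᴹ_ (eval-cong s eq) (eval-cong t eq) p)
  Sat-cong ⊥f       eq ()
  Sat-cong (φ ∧f ψ) eq (p , q)  = Sat-cong φ eq p , Sat-cong ψ eq q
  Sat-cong (φ ∨f ψ) eq (inj₁ p) = inj₁ (Sat-cong φ eq p)
  Sat-cong (φ ∨f ψ) eq (inj₂ q) = inj₂ (Sat-cong ψ eq q)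
  Sat-cong (φ ⇒f ψ) eq h = Sat-cong ψ eq ∘ h ∘ Sat-cong φ (sym ∘ eq)
  Sat-cong (∀f φ)   eq h = λ x → Sat-cong φ (∷-cong refl eq) (h x)
  Sat-cong (∃f φ)   eq (x , p) = x , Sat-cong φ (∷-cong refl eq) p

  ≐-sat : ∀ {a a′ b b′} → a ≡ a′ → b ≡ b′ → Lift m (a ≈ᴹ b) ⇔ (a′ ≈ᴹ b′)
  ≐-sat refl refl = mk⇔ lower lift

  ⋀-sat : ∀ {n k a} {φ : Fin n → Formula k} {ρ : Env k} {A : Fin n → Set a} →
          (∀ i → Sat L (φ i) ρ ⇔ A i) → Sat L (⋀ φ) ρ ⇔ (∀ i → A i)
  ⋀-sat {zero}  _   = mk⇔ (λ _ ()) (λ _ ⊥ → ⊥)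
  ⋀-sat {suc n} φ⇔A = ∀-cons-⇔ ⇔-∘ (φ⇔A zero ×-⇔ ⋀-sat (φ⇔A ∘ suc))

  ++-head : ∀ {n k} (u : Env (suc n)) (ρ : Env k) → (u ++ ρ) ≗ (u zero ∷ (u ∘ suc ++ ρ))
  ++-head {n} u ρ zero = refl
  ++-head {n} u ρ (suc i) with splitAt n i
  ... | inj₁ _ = refl
  ... | inj₂ _ = refl

  ∀ⁿ-sat : ∀ {n k} (φ : Formula (n + k)) {ρ : Env k} →
           Sat L (∀ⁿ {n} φ) ρ ⇔ (∀ u → Sat L φ (u ++ ρ))
  ∀ⁿ-sat {zero}  φ = mk⇔ (λ h _ → h) (λ h → h (λ ()))
  ∀ⁿ-sat {suc n} φ {ρ} = mk⇔
    (λ h u → Sat-cong φ (sym ∘ ++-head u ρ) (Equivalence.to (∀ⁿ-sat (∀f φ)) h (u ∘ suc) (u zero)))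
    (λ h → Equivalence.from (∀ⁿ-sat (∀f φ)) λ v x → Sat-cong φ (++-head (x ∷ v) ρ) (h (x ∷ v)))

  ∀ⁿ-⇔ : ∀ {n k a} {φ : Formula (n + k)} {ρ : Env k} {A : Env n → Set a} →
         (∀ u → Sat L φ (u ++ ρ) ⇔ A u) → Sat L (∀ⁿ {n} φ) ρ ⇔ (∀ u → A u)
  ∀ⁿ-⇔ {φ = φ} φ⇔A = ∀-⇔ φ⇔A ⇔-∘ ∀ⁿ-sat φ

  ∃ⁿ-sat : ∀ {n k} (φ : Formula (n + k)) {ρ : Env k} →
           Sat L (∃ⁿ {n} φ) ρ ⇔ Σ (Env n) (λ u → Sat L φ (u ++ ρ))
  ∃ⁿ-sat {zero}  φ = mk⇔ (λ h → (λ ()) , h) proj₂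
  ∃ⁿ-sat {suc n} φ {ρ} = mk⇔
    (λ h → let (v , x , p) = Equivalence.to (∃ⁿ-sat (∃f φ)) h
           in x ∷ v , Sat-cong φ (sym ∘ ++-head (x ∷ v) ρ) p)
    (λ (u , p) → Equivalence.from (∃ⁿ-sat (∃f φ)) (u ∘ suc , u zero , Sat-cong φ (++-head u ρ) p))

module LieFacts {r ℓr m ℓm} {R : CommutativeRing r ℓr} (L : LieAlgebra R m ℓm) where
  open LieAlgebra L
  open import Algebra.Properties.AbelianGroup +ᴹ-abelianGroup
    using (inverseˡ-unique; ε⁻¹≈ε; x∙y⁻¹≈ε⇒x≈y; x≈y⇒x∙y⁻¹≈ε)
  open import Algebra.Consequences.Setoid ≈ᴹ-setoid
    using (assoc∧distribʳ∧idʳ∧invʳ⇒zeˡ; assoc∧distribˡ∧idʳ∧invʳ⇒zeʳ)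
  open import Algebra.Properties.CommutativeMonoid.Sum +ᴹ-commutativeMonoid
    using (sum; sum-cong-≋; ∑-distrib-+; sum-replicate-zero)
  open import Relation.Binary.Reasoning.Setoid ≈ᴹ-setoid

  ·-zeroˡ : ∀ x → 0ᴹ · x ≈ᴹ 0ᴹ
  ·-zeroˡ = assoc∧distribʳ∧idʳ∧invʳ⇒zeˡ +ᴹ-cong ·-cong +ᴹ-assoc
              (λ z x y → ·-distribʳ x y z) +ᴹ-identityʳ -ᴹ‿inverseʳ

  ·-zeroʳ : ∀ x → x · 0ᴹ ≈ᴹ 0ᴹ
  ·-zeroʳ = assoc∧distribˡ∧idʳ∧invʳ⇒zeʳ +ᴹ-cong ·-cong +ᴹ-assoc ·-distribˡ +ᴹ-identityʳ -ᴹ‿inverseʳ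

  ·-negʳ : ∀ x y → x · (-ᴹ y) ≈ᴹ -ᴹ (x · y)
  ·-negʳ x y = inverseˡ-unique _ _ (begin
    x · (-ᴹ y) +ᴹ x · y  ≈⟨ ·-distribˡ x _ _ ⟨
    x · (-ᴹ y +ᴹ y)      ≈⟨ ·-cong ≈ᴹ-refl (-ᴹ‿inverseˡ y) ⟩
    x · 0ᴹ               ≈⟨ ·-zeroʳ x ⟩
    0ᴹ                   ∎)

  ·-negˡ : ∀ x y → (-ᴹ x) · y ≈ᴹ -ᴹ (x · y)
  ·-negˡ x y = inverseˡ-unique _ _ (begin
    (-ᴹ x) · y +ᴹ x · y  ≈⟨ ·-distribʳ _ _ y ⟨
    (-ᴹ x +ᴹ x) · y      ≈⟨ ·-cong (-ᴹ‿inverseˡ x) ≈ᴹ-refl ⟩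
    0ᴹ · y               ≈⟨ ·-zeroˡ y ⟩
    0ᴹ                   ∎)

  ·-anticomm : ∀ x y → x · y ≈ᴹ -ᴹ (y · x)
  ·-anticomm x y = inverseˡ-unique _ _ (begin
    x · y +ᴹ y · x                          ≈⟨ +ᴹ-cong (+ᴹ-identityˡ _) (+ᴹ-identityʳ _) ⟨
    (0ᴹ +ᴹ x · y) +ᴹ (y · x +ᴹ 0ᴹ)          ≈⟨ +ᴹ-cong (+ᴹ-cong (alternating x) ≈ᴹ-refl)
                                                       (+ᴹ-cong ≈ᴹ-refl (alternating y)) ⟨
    (x · x +ᴹ x · y) +ᴹ (y · x +ᴹ y · y)    ≈⟨ +ᴹ-cong (·-distribˡ x x y) (·-distribˡ y x y) ⟨
    x · (x +ᴹ y) +ᴹ y · (x +ᴹ y)            ≈⟨ ·-distribʳ x y _ ⟨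
    (x +ᴹ y) · (x +ᴹ y)                     ≈⟨ alternating _ ⟩
    0ᴹ                                      ∎)

  ad-hom : ∀ x y z → (x · y) · z ≈ᴹ x · (y · z) +ᴹ -ᴹ (y · (x · z))
  ad-hom x y z = ≈ᴹ-sym (x∙y⁻¹≈ε⇒x≈y _ _ (begin
    x · (y · z) +ᴹ -ᴹ (y · (x · z)) +ᴹ -ᴹ ((x · y) · z)
      ≈⟨ +ᴹ-cong (+ᴹ-cong ≈ᴹ-refl yzx) (≈ᴹ-sym (·-anticomm z _)) ⟩
    x · (y · z) +ᴹ y · (z · x) +ᴹ z · (x · y)  ≈⟨ jacobi x y z ⟩
    0ᴹ                                          ∎))
    where
    yzx : -ᴹ (y · (x · z)) ≈ᴹ y · (z · x)
    yzx = ≈ᴹ-sym (≈ᴹ-trans (·-cong ≈ᴹ-refl (·-anticomm z x)) (·-negʳ y _))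

  ·-annihilates-· : ∀ {x y z} → x · y ≈ᴹ 0ᴹ → x · z ≈ᴹ 0ᴹ → x · (y · z) ≈ᴹ 0ᴹ
  ·-annihilates-· {x} {y} {z} xy≈0 xz≈0 = begin
    x · (y · z)                                ≈⟨ +ᴹ-identityʳ _ ⟨
    x · (y · z) +ᴹ 0ᴹ                          ≈⟨ +ᴹ-identityʳ _ ⟨
    x · (y · z) +ᴹ 0ᴹ +ᴹ 0ᴹ                    ≈⟨ +ᴹ-cong (+ᴹ-cong ≈ᴹ-refl yzx≈0) zxy≈0 ⟨
    x · (y · z) +ᴹ y · (z · x) +ᴹ z · (x · y)  ≈⟨ jacobi x y z ⟩
    0ᴹ                                          ∎
    where
    zx≈0 : z · x ≈ᴹ 0ᴹ
    zx≈0 = ≈ᴹ-trans (·-anticomm z x) (≈ᴹ-trans (-ᴹ‿cong xz≈0) ε⁻¹≈ε)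
    yzx≈0 : y · (z · x) ≈ᴹ 0ᴹ
    yzx≈0 = ≈ᴹ-trans (·-cong ≈ᴹ-refl zx≈0) (·-zeroʳ y)
    zxy≈0 : z · (x · y) ≈ᴹ 0ᴹ
    zxy≈0 = ≈ᴹ-trans (·-cong ≈ᴹ-refl xy≈0) (·-zeroʳ z)

  infix 4 _≋_
  _≋_ : Carrierᴹ → Carrierᴹ → Set (m ⊔ ℓm)
  x ≋ y = ∀ z → x · z ≈ᴹ y · z

  ·-distribʳ-− : ∀ x y z → (x +ᴹ -ᴹ y) · z ≈ᴹ x · z +ᴹ -ᴹ (y · z)
  ·-distribʳ-− x y z = ≈ᴹ-trans (·-distribʳ _ _ _) (+ᴹ-cong ≈ᴹ-refl (·-negˡ y z))

  ≋⇔~ : ∀ {x y} → x ≋ y ⇔ _~_ L x y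
  ≋⇔~ {x} {y} = mk⇔
    (λ x≋y z → ≈ᴹ-trans (·-distribʳ-− x y z) (x≈y⇒x∙y⁻¹≈ε (x≋y z)))
    (λ x~y z → x∙y⁻¹≈ε⇒x≈y _ _ (≈ᴹ-trans (≈ᴹ-sym (·-distribʳ-− x y z)) (x~y z)))

  ≋-refl : ∀ {x} → x ≋ x
  ≋-refl z = ≈ᴹ-refl

  ≋-sym : ∀ {x y} → x ≋ y → y ≋ x
  ≋-sym x≋y z = ≈ᴹ-sym (x≋y z)

  ≋-trans : ∀ {x y w} → x ≋ y → y ≋ w → x ≋ w
  ≋-trans x≋y y≋w z = ≈ᴹ-trans (x≋y z) (y≋w z)

  ≈⇒≋ : ∀ {x y} → x ≈ᴹ y → x ≋ y
  ≈⇒≋ x≈y z = ·-cong x≈y ≈ᴹ-refl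

  ≋-congʳ : ∀ {a b} → a ≋ b → ∀ x → x · a ≈ᴹ x · b
  ≋-congʳ {a} {b} a≋b x = begin
    x · a         ≈⟨ ·-anticomm x a ⟩
    -ᴹ (a · x)    ≈⟨ -ᴹ‿cong (a≋b x) ⟩
    -ᴹ (b · x)    ≈⟨ ·-anticomm x b ⟨
    x · b         ∎

  ≋-+ : ∀ {a b c d} → a ≋ b → c ≋ d → a +ᴹ c ≋ b +ᴹ d
  ≋-+ a≋b c≋d z = begin
    (_ +ᴹ _) · z    ≈⟨ ·-distribʳ _ _ z ⟩
    _ +ᴹ _          ≈⟨ +ᴹ-cong (a≋b z) (c≋d z) ⟩
    _ · z +ᴹ _ · z  ≈⟨ ·-distribʳ _ _ z ⟨
    (_ +ᴹ _) · z    ∎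

  ∑· : ∀ {n} → (Fin n → Carrierᴹ) → (Fin n → Carrierᴹ) → Carrierᴹ
  ∑· A B = sum (λ i → A i · B i)

  ∑·-InSq : ∀ {n} (A B : Fin n → Carrierᴹ) → InSq L (∑· A B)
  ∑·-InSq {zero}  A B = zero
  ∑·-InSq {suc n} A B = add (prod (A zero) (B zero)) (∑·-InSq (A ∘ suc) (B ∘ suc))

  ∑·-congʳ : ∀ {n} (A : Fin n → Carrierᴹ) {B B′ : Fin n → Carrierᴹ} →
             (∀ i → B i ≋ B′ i) → ∑· A B ≈ᴹ ∑· A B′
  ∑·-congʳ A B≋B′ = sum-cong-≋ (λ i → ≋-congʳ (B≋B′ i) (A i))

  ∑·-distrib-+ : ∀ {n} (A B B′ : Fin n → Carrierᴹ) →
                 ∑· A (λ i → B i +ᴹ B′ i) ≈ᴹ ∑· A B +ᴹ ∑· A B′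
  ∑·-distrib-+ A B B′ = ≈ᴹ-trans (sum-cong-≋ (λ i → ·-distribˡ (A i) (B i) (B′ i)))
                                 (∑-distrib-+ (λ i → A i · B i) (λ i → A i · B′ i))

  ∑·-zeroʳ : ∀ {n} (A : Fin n → Carrierᴹ) → ∑· A (λ _ → 0ᴹ) ≈ᴹ 0ᴹ
  ∑·-zeroʳ {n} A = ≈ᴹ-trans (sum-cong-≋ (·-zeroʳ ∘ A)) (sum-replicate-zero n)

  ∑·-*ₗ : ∀ {n} a (A B : Fin n → Carrierᴹ) → a *ₗ ∑· A B ≈ᴹ ∑· A (λ i → a *ₗ B i)
  ∑·-*ₗ {zero}  a A B = *ₗ-zeroʳ a
  ∑·-*ₗ {suc n} a A B = begin
    a *ₗ (A zero · B zero +ᴹ ∑· (A ∘ suc) (B ∘ suc))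
      ≈⟨ *ₗ-distribˡ a _ _ ⟩
    a *ₗ (A zero · B zero) +ᴹ a *ₗ ∑· (A ∘ suc) (B ∘ suc)
      ≈⟨ +ᴹ-cong (≈ᴹ-sym (·-*ₗˡ a _ _)) (∑·-*ₗ a (A ∘ suc) (B ∘ suc)) ⟩
    A zero · (a *ₗ B zero) +ᴹ ∑· (A ∘ suc) (λ i → a *ₗ B (suc i))
      ∎

  ∑·-neg : ∀ {n} (A B : Fin n → Carrierᴹ) → -ᴹ ∑· A B ≈ᴹ ∑· A (λ i → -ᴹ B i)
  ∑·-neg A B = ≈ᴹ-sym (inverseˡ-unique _ _ (begin
    ∑· A (λ i → -ᴹ B i) +ᴹ ∑· A B   ≈⟨ ∑·-distrib-+ A _ B ⟨
    ∑· A (λ i → -ᴹ B i +ᴹ B i)      ≈⟨ ∑·-congʳ A (λ i → ≈⇒≋ (-ᴹ‿inverseˡ (B i))) ⟩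
    ∑· A (λ _ → 0ᴹ)                 ≈⟨ ∑·-zeroʳ A ⟩
    0ᴹ                              ∎))

  single : ∀ {n} → Fin n → Carrierᴹ → Fin n → Carrierᴹ
  single zero    y = y ∷ λ _ → 0ᴹ
  single (suc i) y = 0ᴹ ∷ single i y

  ∑·-single : ∀ {n} (A : Fin n → Carrierᴹ) i y → ∑· A (single i y) ≈ᴹ A i · y
  ∑·-single A zero    y = ≈ᴹ-trans (+ᴹ-cong ≈ᴹ-refl (∑·-zeroʳ (A ∘ suc))) (+ᴹ-identityʳ _)
  ∑·-single A (suc i) y = ≈ᴹ-trans (+ᴹ-cong (·-zeroʳ (A zero)) (∑·-single (A ∘ suc) i y))
                                   (+ᴹ-identityˡ _)

module ScalarCodes {r ℓr m ℓm} {R : CommutativeRing r ℓr} (L : LieAlgebra R m ℓm) where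
  open LieAlgebra L
  open LieFacts L
  open import Algebra.Properties.AbelianGroup +ᴹ-abelianGroup using (identityʳ-unique; x≈y⇒x∙y⁻¹≈ε)
  open import Relation.Binary.Reasoning.Setoid ≈ᴹ-setoid

  private
    V : ℕ → Set m
    V n = Fin n → Carrierᴹ

  module _ (p : Scalar L) where

    σ-zero : proj₁ (σ p (0Sq L)) ≈ᴹ 0ᴹ
    σ-zero = identityʳ-unique _ _ (≈ᴹ-trans (≈ᴹ-sym (σ-add p (0Sq L) (0Sq L)))
                                            (σ-cong p (+ᴹ-identityˡ 0ᴹ)))

    σ-∑·-InSq : ∀ {n} (A B : V n) → proj₁ (σ p (∑· A B , ∑·-InSq A B)) ≈ᴹ ∑· A (α₂ p ∘ B)
    σ-∑·-InSq {zero}  A B = σ-zero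
    σ-∑·-InSq {suc n} A B = ≈ᴹ-trans (σ-add p _ _)
      (+ᴹ-cong (≈ᴹ-sym (balanced₂ p (A zero) (B zero))) (σ-∑·-InSq (A ∘ suc) (B ∘ suc)))

    σ-∑· : ∀ {n} (A B : V n) (v : Sq L) → proj₁ v ≈ᴹ ∑· A B → proj₁ (σ p v) ≈ᴹ ∑· A (α₂ p ∘ B)
    σ-∑· A B v v≈AB = ≈ᴹ-trans (σ-cong p v≈AB) (σ-∑·-InSq A B)

    -- Apply balanced₂ to y x and to (-x) y, which have the same product.
    α₁≋α₂ : ∀ y → α₁ p y ≋ α₂ p y
    α₁≋α₂ y x = begin
      α₁ p y · x                                  ≈⟨ balanced₁ p y x ⟩
      y · α₂ p x                                  ≈⟨ balanced₂ p y x ⟩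
      proj₁ (σ p (y · x , prod y x))              ≈⟨ σ-cong p yx≈-x·y ⟩
      proj₁ (σ p ((-ᴹ x) · y , prod (-ᴹ x) y))    ≈⟨ balanced₂ p (-ᴹ x) y ⟨
      (-ᴹ x) · α₂ p y                             ≈⟨ ·-negˡ x _ ⟩
      -ᴹ (x · α₂ p y)                             ≈⟨ ·-anticomm _ x ⟨
      α₂ p y · x                                  ∎
      where
      yx≈-x·y : y · x ≈ᴹ (-ᴹ x) · y
      yx≈-x·y = ≈ᴹ-trans (·-anticomm y x) (≈ᴹ-sym (·-negˡ x y))

  module _ {n : ℕ} where

    Faithful : V n → Set (m ⊔ ℓm)
    Faithful E = ∀ x → (∀ i → x · E i ≈ᴹ 0ᴹ) → InAnn L x

    SpansSquare : V n → Set (m ⊔ ℓm)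
    SpansSquare E = ∀ x y → Σ (V n) λ z → x · y ≈ᴹ ∑· E z

    Image : V n → V n → Carrierᴹ → Carrierᴹ → Set ℓm
    Image E W x s = ∀ i → s · E i ≈ᴹ x · W i

    Images : V n → V n → V n → V n → Set ℓm
    Images E W z t = ∀ i → Image E W (z i) (t i)

    HasImages : V n → V n → Set (m ⊔ ℓm)
    HasImages E W = ∀ x → Σ Carrierᴹ (Image E W x)

    Balanced : V n → V n → Set (m ⊔ ℓm)
    Balanced E W = ∀ x y s t → Image E W x s → Image E W y t → s · y ≈ᴹ x · t

    ImagesRespect-∑· : V n → V n → Set (m ⊔ ℓm)
    ImagesRespect-∑· E W = ∀ z z′ t t′ → Images E W z t → Images E W z′ t′ →
                           ∑· E z ≈ᴹ ∑· E z′ → ∑· E t ≈ᴹ ∑· E t′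

    ImagesRespect-· : V n → V n → Set (m ⊔ ℓm)
    ImagesRespect-· E W = ∀ x y s z t → Image E W y s → Images E W z t →
                          x · y ≈ᴹ ∑· E z → x · s ≈ᴹ ∑· E t

    record IsScalarCode (E W : V n) : Set (m ⊔ ℓm) where
      field
        faithful     : Faithful E
        spans        : SpansSquare E
        hasImages    : HasImages E W
        balanced     : Balanced E W
        respects-∑·  : ImagesRespect-∑· E W
        respects-·   : ImagesRespect-· E W

    Faithful⇒≋ : ∀ {E} → Faithful E → ∀ {a b} → (∀ i → a · E i ≈ᴹ b · E i) → a ≋ b
    Faithful⇒≋ {E} faithful {a} {b} aE≈bE = Equivalence.from ≋⇔~
      (faithful (a +ᴹ -ᴹ b) (λ i → ≈ᴹ-trans (·-distribʳ-− a b (E i)) (x≈y⇒x∙y⁻¹≈ε (aE≈bE i))))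

    image-unique : ∀ {E W} → Faithful E → ∀ {x s s′} → Image E W x s → Image E W x s′ → s ≋ s′
    image-unique faithful s-img s′-img = Faithful⇒≋ faithful (λ i → ≈ᴹ-trans (s-img i) (≈ᴹ-sym (s′-img i)))

    Image-resp-≗ : ∀ {E E′ W W′ x s} → E ≗ E′ → W ≗ W′ → Image E W x s → Image E′ W′ x s
    Image-resp-≗ {x = x} {s} E≗E′ W≗W′ s-img i = subst₂ (λ a b → s · a ≈ᴹ x · b) (E≗E′ i) (W≗W′ i) (s-img i)

    module _ {E : V n} (spans : SpansSquare E) where

      coeffs : ∀ {u} → InSq L u → V n
      coeffs (prod x y)  = proj₁ (spans x y)
      coeffs zero        = λ _ → 0ᴹ
      coeffs (add p q)   = λ i → coeffs p i +ᴹ coeffs q i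
      coeffs (smul a p)  = λ i → a *ₗ coeffs p i
      coeffs (resp _ p)  = coeffs p

      coeffs-spec : ∀ {u} (p : InSq L u) → u ≈ᴹ ∑· E (coeffs p)
      coeffs-spec (prod x y)  = proj₂ (spans x y)
      coeffs-spec zero        = ≈ᴹ-sym (∑·-zeroʳ E)
      coeffs-spec (add p q)   = ≈ᴹ-trans (+ᴹ-cong (coeffs-spec p) (coeffs-spec q))
                                         (≈ᴹ-sym (∑·-distrib-+ E _ _))
      coeffs-spec (smul a p)  = ≈ᴹ-trans (*ₗ-cong (CommutativeRing.refl R) (coeffs-spec p)) (∑·-*ₗ a E _)
      coeffs-spec (resp e p)  = ≈ᴹ-trans (≈ᴹ-sym e) (coeffs-spec p)

    module Decode {E W : V n} (c : IsScalarCode E W) where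
      open IsScalarCode c

      α : Carrierᴹ → Carrierᴹ
      α x = proj₁ (hasImages x)

      α-image : ∀ x → Image E W x (α x)
      α-image x = proj₂ (hasImages x)

      α-unique : ∀ {x s} → Image E W x s → s ≋ α x
      α-unique s-img = image-unique faithful s-img (α-image _)

      α-cong : ∀ {x y} → x ≋ y → α x ≋ α y
      α-cong {x} {y} x≋y = Faithful⇒≋ faithful λ i → begin
        α x · E i  ≈⟨ α-image x i ⟩
        x · W i    ≈⟨ x≋y (W i) ⟩
        y · W i    ≈⟨ α-image y i ⟨
        α y · E i  ∎

      α-+ : ∀ x y → α (x +ᴹ y) ≋ α x +ᴹ α y
      α-+ x y = Faithful⇒≋ faithful λ i → begin
        α (x +ᴹ y) · E i          ≈⟨ α-image _ i ⟩
        (x +ᴹ y) · W i            ≈⟨ ·-distribʳ _ _ _ ⟩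
        x · W i +ᴹ y · W i        ≈⟨ +ᴹ-cong (α-image x i) (α-image y i) ⟨
        α x · E i +ᴹ α y · E i    ≈⟨ ·-distribʳ _ _ _ ⟨
        (α x +ᴹ α y) · E i        ∎

      σ̂ : Sq L → Sq L
      σ̂ (_ , p) = ∑· E (α ∘ coeffs spans p) , ∑·-InSq E _

      scalar : Scalar L
      scalar = record
        { α₁ = α ; α₂ = α ; σ = σ̂
        ; α₁-cong = λ x~y → to ≋⇔~ (α-cong (from ≋⇔~ x~y))
        ; α₁-add = λ x y → to ≋⇔~ (α-+ x y)
        ; α₂-cong = λ x~y → to ≋⇔~ (α-cong (from ≋⇔~ x~y))
        ; α₂-add = λ x y → to ≋⇔~ (α-+ x y)
        ; σ-cong = λ { {_ , p} {_ , q} u≈v → respects-∑· _ _ _ _ (α-image ∘ coeffs spans p) (α-image ∘ coeffs spans q)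
                         (≈ᴹ-trans (≈ᴹ-sym (coeffs-spec spans p)) (≈ᴹ-trans u≈v (coeffs-spec spans q))) }
        ; σ-add = λ { (_ , p) (_ , q) → ≈ᴹ-trans (∑·-congʳ E (λ i → α-+ _ _))
                                                 (∑·-distrib-+ E (α ∘ coeffs spans p) (α ∘ coeffs spans q)) }
        ; balanced₁ = λ x y → balanced x y (α x) (α y) (α-image x) (α-image y)
        ; balanced₂ = λ x y → respects-· x y (α y) _ _ (α-image y) (α-image ∘ proj₁ (spans x y)) (proj₂ (spans x y))
        }
        where open Equivalence

      ≈P-scalar : (q : Scalar L) → (∀ x → α x ≋ α₁ q x) → _≈P_ L scalar q
      ≈P-scalar q α≋α₁ =
        (λ x → to ≋⇔~ (α≋α₁ x)) , (λ x → to ≋⇔~ (≋-trans (α≋α₁ x) (α₁≋α₂ q x))) ,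
        λ { (u , p) → ≈ᴹ-sym (≈ᴹ-trans (σ-∑· q E (coeffs spans p) (u , p) (coeffs-spec spans p))
                                       (∑·-congʳ E λ i → ≋-sym (≋-trans (α≋α₁ _) (α₁≋α₂ q _)))) }
        where open Equivalence

    decode : ∀ {E W} → IsScalarCode E W → Scalar L
    decode = Decode.scalar

    module _ {E W : V n} (c : IsScalarCode E W) where
      private module C = Decode c
      open Equivalence
      open IsScalarCode c using (spans)

      α₁-decode⇔ : ∀ {x y} → (∀ s → Image E W x s → s ≋ y) ⇔ _~_ L (α₁ (decode c) x) y
      α₁-decode⇔ {x} = mk⇔ (λ h → to ≋⇔~ (h (C.α x) (C.α-image x)))
                           (λ αx~y s s-img → ≋-trans (C.α-unique s-img) (from ≋⇔~ αx~y))

      σ-decode⇔ : (X Y X′ Y′ : V n) →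
                  (∀ t → Images E W Y t → ∑· X t ≈ᴹ ∑· X′ Y′) ⇔
                  _≈Sq_ L (σ (decode c) (∑· X Y , ∑·-InSq X Y)) (∑· X′ Y′ , ∑·-InSq X′ Y′)
      σ-decode⇔ X Y X′ Y′ = mk⇔
        (λ h → ≈ᴹ-trans σXY (h (C.α ∘ Y) (C.α-image ∘ Y)))
        (λ σXY≈ t t-img → ≈ᴹ-trans (∑·-congʳ X (C.α-unique ∘ t-img)) (≈ᴹ-trans (≈ᴹ-sym σXY) σXY≈))
        where
        σXY : proj₁ (σ (decode c) (∑· X Y , ∑·-InSq X Y)) ≈ᴹ ∑· X (C.α ∘ Y)
        σXY = σ-∑·-InSq (decode c) X Y

      IsZeroP-decode⇔ : (∀ x s → Image E W x s → s ≋ 0ᴹ) ⇔ IsZeroP L (decode c)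
      IsZeroP-decode⇔ = mk⇔
        (λ h → let α≋0 = λ x → h x (C.α x) (C.α-image x) in
          (to ≋⇔~ ∘ α≋0) , (to ≋⇔~ ∘ α≋0) ,
          λ { (_ , p) → ≈ᴹ-trans (∑·-congʳ E (α≋0 ∘ coeffs spans p)) (∑·-zeroʳ E) })
        (λ (α~0 , _) x s s-img → ≋-trans (C.α-unique s-img) (from ≋⇔~ (α~0 x)))

      IsOneP-decode⇔ : (∀ x s → Image E W x s → s ≋ x) ⇔ IsOneP L (decode c)
      IsOneP-decode⇔ = mk⇔
        (λ h → let α≋id = λ x → h x (C.α x) (C.α-image x) in
          (to ≋⇔~ ∘ α≋id) , (to ≋⇔~ ∘ α≋id) ,
          λ { (_ , p) → ≈ᴹ-trans (∑·-congʳ E (α≋id ∘ coeffs spans p)) (≈ᴹ-sym (coeffs-spec spans p)) })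
        (λ (α~id , _) x s s-img → ≋-trans (C.α-unique s-img) (from ≋⇔~ (α~id x)))

    module _ {E W E′ W′ : V n} (c : IsScalarCode E W) (c′ : IsScalarCode E′ W′) where
      private
        module C = Decode c
        module C′ = Decode c′
      open Equivalence

      ≈P-decode⇔ : (∀ x s s′ → Image E W x s → Image E′ W′ x s′ → s ≋ s′) ⇔
                   _≈P_ L (decode c) (decode c′)
      ≈P-decode⇔ = mk⇔
        (λ h → C.≈P-scalar (decode c′) (λ x → h x _ _ (C.α-image x) (C′.α-image x)))
        (λ (α~α′ , _) x s s′ s-img s′-img →
          ≋-trans (C.α-unique s-img) (≋-trans (from ≋⇔~ (α~α′ x)) (≋-sym (C′.α-unique s′-img))))

      module _ {E″ W″ : V n} (c″ : IsScalarCode E″ W″) where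
        private module C″ = Decode c″
        open IsScalarCode c″ using (spans)

        IsSumP-decode⇔ : (∀ x a b s → Image E W x a → Image E′ W′ x b → Image E″ W″ x s → s ≋ a +ᴹ b) ⇔
                         IsSumP L (decode c) (decode c′) (decode c″)
        IsSumP-decode⇔ = mk⇔
          (λ h → let α″≋α+α′ = λ x → h x _ _ _ (C.α-image x) (C′.α-image x) (C″.α-image x) in
            (to ≋⇔~ ∘ α″≋α+α′) , (to ≋⇔~ ∘ α″≋α+α′) ,
            λ { (u , p) → let k = coeffs spans p in begin
              ∑· E″ (C″.α ∘ k)                       ≈⟨ ∑·-congʳ E″ (α″≋α+α′ ∘ k) ⟩
              ∑· E″ (λ i → C.α (k i) +ᴹ C′.α (k i))  ≈⟨ ∑·-distrib-+ E″ _ _ ⟩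
              ∑· E″ (C.α ∘ k) +ᴹ ∑· E″ (C′.α ∘ k)
                ≈⟨ +ᴹ-cong (σ-∑· (decode c) E″ k (u , p) (coeffs-spec spans p))
                           (σ-∑· (decode c′) E″ k (u , p) (coeffs-spec spans p)) ⟨
              proj₁ (σ (decode c) (u , p)) +ᴹ proj₁ (σ (decode c′) (u , p)) ∎ })
          (λ (α″~α+α′ , _) x a b s a-img b-img s-img →
            ≋-trans (C″.α-unique s-img)
              (≋-trans (from ≋⇔~ (α″~α+α′ x)) (≋-+ (≋-sym (C.α-unique a-img)) (≋-sym (C′.α-unique b-img)))))

        IsProdP-decode⇔ : (∀ x a b s → Image E′ W′ x a → Image E W a b → Image E″ W″ x s → s ≋ b) ⇔
                          IsProdP L (decode c) (decode c′) (decode c″)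
        IsProdP-decode⇔ = mk⇔
          (λ h → let α″≋αα′ = λ x → h x _ _ _ (C′.α-image x) (C.α-image _) (C″.α-image x) in
            (to ≋⇔~ ∘ α″≋αα′) , (to ≋⇔~ ∘ α″≋αα′) ,
            λ { (u , p) → let k = coeffs spans p
                              σ′u = σ-∑· (decode c′) E″ k (u , p) (coeffs-spec spans p) in begin
              ∑· E″ (C″.α ∘ k)                  ≈⟨ ∑·-congʳ E″ (α″≋αα′ ∘ k) ⟩
              ∑· E″ (C.α ∘ C′.α ∘ k)            ≈⟨ σ-∑· (decode c) E″ (C′.α ∘ k) (σ (decode c′) (u , p)) σ′u ⟨
              proj₁ (σ (decode c) (σ (decode c′) (u , p))) ∎ })
          (λ (α″~αα′ , _) x a b s a-img b-img s-img →
            ≋-trans (C″.α-unique s-img) (≋-trans (from ≋⇔~ (α″~αα′ x))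
              (≋-trans (C.α-cong (≋-sym (C′.α-unique a-img))) (≋-sym (C.α-unique b-img)))))

module Generators {r ℓr m ℓm} {R : CommutativeRing r ℓr} (L : LieAlgebra R m ℓm)
                  {n} (g : Fin n → LieAlgebra.Carrierᴹ L) (generates : Generates L g) where
  open LieAlgebra L
  open LieFacts L
  open ScalarCodes L
  open import Relation.Binary.Reasoning.Setoid ≈ᴹ-setoid

  generators-faithful : Faithful g
  generators-faithful x xg≈0 y = annihilates (generates y)
    where
    annihilates : ∀ {y} → InSubalg L g y → x · y ≈ᴹ 0ᴹ
    annihilates (gen i)    = xg≈0 i
    annihilates zero       = ·-zeroʳ x
    annihilates (add p q)  = ≈ᴹ-trans (·-distribˡ x _ _)
                               (≈ᴹ-trans (+ᴹ-cong (annihilates p) (annihilates q)) (+ᴹ-identityˡ 0ᴹ))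
    annihilates (smul a p) = ≈ᴹ-trans (·-*ₗˡ a x _)
                               (≈ᴹ-trans (*ₗ-cong (CommutativeRing.refl R) (annihilates p)) (*ₗ-zeroʳ a))
    annihilates (brk p q)  = ·-annihilates-· (annihilates p) (annihilates q)
    annihilates (resp e p) = ≈ᴹ-trans (·-cong ≈ᴹ-refl (≈ᴹ-sym e)) (annihilates p)

  generators-span : SpansSquare g
  generators-span x = span (generates x)
    where
    span : ∀ {x} → InSubalg L g x → ∀ y → Σ (Fin n → Carrierᴹ) λ z → x · y ≈ᴹ ∑· g z
    span (gen i) y = single i y , ≈ᴹ-sym (∑·-single g i y)
    span zero y = (λ _ → 0ᴹ) , ≈ᴹ-trans (·-zeroˡ y) (≈ᴹ-sym (∑·-zeroʳ g))
    span (add {x₁} {x₂} p q) y =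
      let (z₁ , x₁y≈) = span p y ; (z₂ , x₂y≈) = span q y in
      (λ i → z₁ i +ᴹ z₂ i) , (begin
        (x₁ +ᴹ x₂) · y        ≈⟨ ·-distribʳ _ _ _ ⟩
        x₁ · y +ᴹ x₂ · y      ≈⟨ +ᴹ-cong x₁y≈ x₂y≈ ⟩
        ∑· g z₁ +ᴹ ∑· g z₂    ≈⟨ ∑·-distrib-+ g z₁ z₂ ⟨
        ∑· g (λ i → z₁ i +ᴹ z₂ i) ∎)
    span (smul a {x₁} p) y =
      let (z , x₁y≈) = span p y in
      (λ i → a *ₗ z i) , (begin
        (a *ₗ x₁) · y   ≈⟨ ·-*ₗʳ a x₁ y ⟩
        a *ₗ (x₁ · y)   ≈⟨ *ₗ-cong (CommutativeRing.refl R) x₁y≈ ⟩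
        a *ₗ ∑· g z     ≈⟨ ∑·-*ₗ a g z ⟩
        ∑· g (λ i → a *ₗ z i) ∎)
    span (brk {x₁} {x₂} p q) y =
      let (z₁ , x₁x₂y≈) = span p (x₂ · y) ; (z₂ , x₂x₁y≈) = span q (x₁ · y) in
      (λ i → z₁ i +ᴹ -ᴹ z₂ i) , (begin
        (x₁ · x₂) · y                          ≈⟨ ad-hom x₁ x₂ y ⟩
        x₁ · (x₂ · y) +ᴹ -ᴹ (x₂ · (x₁ · y))    ≈⟨ +ᴹ-cong x₁x₂y≈ (-ᴹ‿cong x₂x₁y≈) ⟩
        ∑· g z₁ +ᴹ -ᴹ ∑· g z₂                  ≈⟨ +ᴹ-cong ≈ᴹ-refl (∑·-neg g z₂) ⟩
        ∑· g z₁ +ᴹ ∑· g (λ i → -ᴹ z₂ i)        ≈⟨ ∑·-distrib-+ g _ _ ⟨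
        ∑· g (λ i → z₁ i +ᴹ -ᴹ z₂ i)           ∎)
    span (resp e p) y =
      let (z , xy≈) = span p y in z , ≈ᴹ-trans (·-cong (≈ᴹ-sym e) ≈ᴹ-refl) xy≈

  module _ (p : Scalar L) where

    scalar-image : ∀ x → Image g (α₂ p ∘ g) x (α₁ p x)
    scalar-image x = balanced₁ p x ∘ g

    private
      image≋α₂ : ∀ {x s} → Image g (α₂ p ∘ g) x s → s ≋ α₂ p x
      image≋α₂ s-img = ≋-trans (image-unique generators-faithful s-img (scalar-image _)) (α₁≋α₂ p _)

    scalar-code : IsScalarCode g (α₂ p ∘ g)
    scalar-code = record
      { faithful = generators-faithful
      ; spans = generators-span
      ; hasImages = λ x → α₁ p x , scalar-image x
      ; balanced = λ x y s t s-img t-img → begin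
          s · y          ≈⟨ image≋α₂ s-img y ⟩
          α₂ p x · y     ≈⟨ α₁≋α₂ p x y ⟨
          α₁ p x · y     ≈⟨ balanced₁ p x y ⟩
          x · α₂ p y     ≈⟨ ≋-congʳ (image≋α₂ t-img) x ⟨
          x · t          ∎
      ; respects-∑· = λ z z′ t t′ t-img t′-img gz≈gz′ → begin
          ∑· g t                                  ≈⟨ ∑·-congʳ g (image≋α₂ ∘ t-img) ⟩
          ∑· g (α₂ p ∘ z)                         ≈⟨ σ-∑·-InSq p g z ⟨
          proj₁ (σ p (∑· g z , ∑·-InSq g z))      ≈⟨ σ-∑· p g z′ (∑· g z , ∑·-InSq g z) gz≈gz′ ⟩
          ∑· g (α₂ p ∘ z′)                        ≈⟨ ∑·-congʳ g (image≋α₂ ∘ t′-img) ⟨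
          ∑· g t′                                 ∎
      ; respects-· = λ x y s z t s-img t-img xy≈gz → begin
          x · s                             ≈⟨ ≋-congʳ (image≋α₂ s-img) x ⟩
          x · α₂ p y                        ≈⟨ balanced₂ p x y ⟩
          proj₁ (σ p (x · y , prod x y))    ≈⟨ σ-∑· p g z (x · y , prod x y) xy≈gz ⟩
          ∑· g (α₂ p ∘ z)                   ≈⟨ ∑·-congʳ g (image≋α₂ ∘ t-img) ⟨
          ∑· g t                            ∎
      }

-- Each formula binds its variables in the order in which the statement on the
-- right of the matching ‹…›-sat lemma quantifies them; de Bruijn index 0F is
-- the innermost one.
module Syntax (n : ℕ) where

  wk : ∀ j {k} → (Fin n → Fin k) → Fin n → Fin (j + k)
  wk j e = (j ↑ʳ_) ∘ e

  ext : ∀ {j} k → (Fin n → Fin j) → Fin n → Fin (j + k)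
  ext k e = (_↑ˡ k) ∘ e

  new : ∀ k → Fin n → Fin (n + k)
  new k = _↑ˡ k

  ∑·ᵗ : ∀ {k} → (a b : Fin n → Fin k) → Term k
  ∑·ᵗ a b = ∑ᵗ λ i → var (a i) ⊗ var (b i)

  Imageᶠ : ∀ {k} (e w : Fin n → Fin k) (x s : Fin k) → Formula k
  Imageᶠ e w x s = ⋀ λ i → var s ⊗ var (e i) ≐ var x ⊗ var (w i)

  Imagesᶠ : ∀ {k} (e w z t : Fin n → Fin k) → Formula k
  Imagesᶠ e w z t = ⋀ λ i → Imageᶠ e w (z i) (t i)

  Faithfulᶠ : ∀ {k} (e : Fin n → Fin k) → Formula k
  Faithfulᶠ e = ∀f ((⋀ λ i → var zero ⊗ var (suc (e i)) ≐ zer) ⇒f ∀f (var 1F ⊗ var 0F ≐ zer))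

  SpansSquareᶠ : ∀ {k} (e : Fin n → Fin k) → Formula k
  SpansSquareᶠ {k} e =
    ∀f (∀f (∃ⁿ {n} (var (n ↑ʳ 1F) ⊗ var (n ↑ʳ 0F) ≐ ∑·ᵗ (wk n (wk 2 e)) (new (2 + k)))))

  HasImagesᶠ : ∀ {k} (e w : Fin n → Fin k) → Formula k
  HasImagesᶠ e w = ∀f (∃f (Imageᶠ (wk 2 e) (wk 2 w) 1F 0F))

  Balancedᶠ : ∀ {k} (e w : Fin n → Fin k) → Formula k
  Balancedᶠ e w = ∀f (∀f (∀f (∀f
    (Imageᶠ (wk 4 e) (wk 4 w) 3F 1F ⇒f (Imageᶠ (wk 4 e) (wk 4 w) 2F 0F ⇒f
      (var 1F ⊗ var 2F ≐ var 3F ⊗ var 0F))))))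

  ImagesRespect-∑·ᶠ : ∀ {k} (e w : Fin n → Fin k) → Formula k
  ImagesRespect-∑·ᶠ {k} e w = ∀ⁿ {n} (∀ⁿ {n} (∀ⁿ {n} (∀ⁿ {n}
    (Imagesᶠ e₄ w₄ z t ⇒f (Imagesᶠ e₄ w₄ z′ t′ ⇒f
      ((∑·ᵗ e₄ z ≐ ∑·ᵗ e₄ z′) ⇒f (∑·ᵗ e₄ t ≐ ∑·ᵗ e₄ t′)))))))
    where
    e₄ = wk n (wk n (wk n (wk n e)))
    w₄ = wk n (wk n (wk n (wk n w)))
    z  = wk n (wk n (wk n (new k)))
    z′ = wk n (wk n (new (n + k)))
    t  = wk n (new (n + (n + k)))
    t′ = new (n + (n + (n + k)))

  ImagesRespect-·ᶠ : ∀ {k} (e w : Fin n → Fin k) → Formula k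
  ImagesRespect-·ᶠ {k} e w = ∀f (∀f (∀f (∀ⁿ {n} (∀ⁿ {n}
    (Imageᶠ e₂ w₂ y s ⇒f (Imagesᶠ e₂ w₂ z t ⇒f
      ((var x ⊗ var y ≐ ∑·ᵗ e₂ z) ⇒f (var x ⊗ var s ≐ ∑·ᵗ e₂ t))))))))
    where
    e₂ = wk n (wk n (wk 3 e))
    w₂ = wk n (wk n (wk 3 w))
    x  = n ↑ʳ (n ↑ʳ 2F)
    y  = n ↑ʳ (n ↑ʳ 1F)
    s  = n ↑ʳ (n ↑ʳ 0F)
    z  = wk n (new (3 + k))
    t  = new (n + (3 + k))

  IsScalarCodeᶠ : ∀ {k} (e w : Fin n → Fin k) → Formula k
  IsScalarCodeᶠ e w = Faithfulᶠ e ∧f (SpansSquareᶠ e ∧f (HasImagesᶠ e w ∧f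
    (Balancedᶠ e w ∧f (ImagesRespect-∑·ᶠ e w ∧f ImagesRespect-·ᶠ e w))))

  ≈Pᶠ : ∀ {k} (e w e′ w′ : Fin n → Fin k) → Formula k
  ≈Pᶠ e w e′ w′ = ∀f (∀f (∀f
    (Imageᶠ (wk 3 e) (wk 3 w) 2F 1F ⇒f (Imageᶠ (wk 3 e′) (wk 3 w′) 2F 0F ⇒f
      ∀f (var 2F ⊗ var 0F ≐ var 1F ⊗ var 0F)))))

  IsZeroPᶠ : ∀ {k} (e w : Fin n → Fin k) → Formula k
  IsZeroPᶠ e w = ∀f (∀f (Imageᶠ (wk 2 e) (wk 2 w) 1F 0F ⇒f ∀f (var 1F ⊗ var 0F ≐ zer ⊗ var 0F)))

  IsOnePᶠ : ∀ {k} (e w : Fin n → Fin k) → Formula k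
  IsOnePᶠ e w = ∀f (∀f (Imageᶠ (wk 2 e) (wk 2 w) 1F 0F ⇒f ∀f (var 1F ⊗ var 0F ≐ var 2F ⊗ var 0F)))

  IsSumPᶠ : ∀ {k} (e w e′ w′ e″ w″ : Fin n → Fin k) → Formula k
  IsSumPᶠ e w e′ w′ e″ w″ = ∀f (∀f (∀f (∀f
    (Imageᶠ (wk 4 e) (wk 4 w) 3F 2F ⇒f (Imageᶠ (wk 4 e′) (wk 4 w′) 3F 1F ⇒f
      (Imageᶠ (wk 4 e″) (wk 4 w″) 3F 0F ⇒f ∀f (var 1F ⊗ var 0F ≐ (var 3F ⊕ var 2F) ⊗ var 0F)))))))

  IsProdPᶠ : ∀ {k} (e w e′ w′ e″ w″ : Fin n → Fin k) → Formula k
  IsProdPᶠ e w e′ w′ e″ w″ = ∀f (∀f (∀f (∀f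
    (Imageᶠ (wk 4 e′) (wk 4 w′) 3F 2F ⇒f (Imageᶠ (wk 4 e) (wk 4 w) 2F 1F ⇒f
      (Imageᶠ (wk 4 e″) (wk 4 w″) 3F 0F ⇒f ∀f (var 1F ⊗ var 0F ≐ var 2F ⊗ var 0F)))))))

  Actᴹᶠ : ∀ {k} (e w : Fin n → Fin k) (x y : Fin k) → Formula k
  Actᴹᶠ e w x y = ∀f (Imageᶠ (wk 1 e) (wk 1 w) (suc x) 0F ⇒f
    ∀f (var 1F ⊗ var 0F ≐ var (suc (suc y)) ⊗ var 0F))

  Actᴺᶠ : ∀ {k} (e w xs ys xs′ ys′ : Fin n → Fin k) → Formula k
  Actᴺᶠ {k} e w xs ys xs′ ys′ = ∀ⁿ {n} (Imagesᶠ (wk n e) (wk n w) (wk n ys) (new k) ⇒f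
    (∑·ᵗ (wk n xs) (new k) ≐ ∑·ᵗ (wk n xs′) (wk n ys′)))

module Satisfaction {r ℓr m ℓm} {R : CommutativeRing r ℓr} (L : LieAlgebra R m ℓm) (n : ℕ) where
  open LieAlgebra L
  open Semantics L
  open LieFacts L
  open ScalarCodes L
  open Syntax n
  open import Algebra.Properties.CommutativeMonoid.Sum +ᴹ-commutativeMonoid using (sum-cong-≗)

  private
    V = Fin n → Carrierᴹ

  ∑·ᵗ-eval : ∀ {k} {ρ : Env k} {a b A B} → ρ ∘ a ≗ A → ρ ∘ b ≗ B → eval L (∑·ᵗ a b) ρ ≡ ∑· A B
  ∑·ᵗ-eval {ρ = ρ} {a} {b} ρa≗A ρb≗B =
    trans (eval-∑ᵗ (λ i → var (a i) ⊗ var (b i)) ρ) (sum-cong-≗ (λ i → cong₂ _·_ (ρa≗A i) (ρb≗B i)))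

  wk-lookup : ∀ {j k} (u : Env j) {ρ : Env k} {e E} → ρ ∘ e ≗ E → (u ++ ρ) ∘ wk j e ≗ E
  wk-lookup u {ρ} {e} ρe≗E i = trans (lookup-++ʳ u ρ (e i)) (ρe≗E i)

  new-lookup : ∀ {k} (u : V) (ρ : Env k) → (u ++ ρ) ∘ new k ≗ u
  new-lookup u ρ = lookup-++ˡ u ρ

  Image-sat : ∀ {k} {ρ : Env k} {e w E W x s X S} → ρ ∘ e ≗ E → ρ ∘ w ≗ W → ρ x ≡ X → ρ s ≡ S →
              Sat L (Imageᶠ e w x s) ρ ⇔ Image E W X S
  Image-sat ρe≗E ρw≗W ρx≡X ρs≡S =
    ⋀-sat λ i → ≐-sat (cong₂ _·_ ρs≡S (ρe≗E i)) (cong₂ _·_ ρx≡X (ρw≗W i))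

  Images-sat : ∀ {k} {ρ : Env k} {e w z t E W Z T} → ρ ∘ e ≗ E → ρ ∘ w ≗ W → ρ ∘ z ≗ Z → ρ ∘ t ≗ T →
               Sat L (Imagesᶠ e w z t) ρ ⇔ Images E W Z T
  Images-sat ρe≗E ρw≗W ρz≗Z ρt≗T = ⋀-sat λ i → Image-sat ρe≗E ρw≗W (ρz≗Z i) (ρt≗T i)

  module _ {k} {ρ : Env k} {e w : Fin n → Fin k} {E W : V} (ρe≗E : ρ ∘ e ≗ E) (ρw≗W : ρ ∘ w ≗ W) where

    Faithful-sat : Sat L (Faithfulᶠ e) ρ ⇔ Faithful E
    Faithful-sat = ∀-⇔ λ x → →-cong-⇔ (⋀-sat λ i → ≐-sat (cong (x ·_) (ρe≗E i)) refl)
                                       (∀-⇔ λ _ → ≐-sat refl refl)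

    SpansSquare-sat : Sat L (SpansSquareᶠ e) ρ ⇔ SpansSquare E
    SpansSquare-sat = ∀-⇔ λ x → ∀-⇔ λ y → ∃-⇔ (λ z →
      ≐-sat (cong₂ _·_ (lookup-++ʳ z (y ∷ x ∷ ρ) 1F) (lookup-++ʳ z (y ∷ x ∷ ρ) 0F))
            (∑·ᵗ-eval (wk-lookup z ρe≗E) (new-lookup z (y ∷ x ∷ ρ))))
      ⇔-∘ ∃ⁿ-sat _

    HasImages-sat : Sat L (HasImagesᶠ e w) ρ ⇔ HasImages E W
    HasImages-sat = ∀-⇔ λ _ → ∃-⇔ λ _ → Image-sat ρe≗E ρw≗W refl refl

    Balanced-sat : Sat L (Balancedᶠ e w) ρ ⇔ Balanced E W
    Balanced-sat = ∀-⇔ λ _ → ∀-⇔ λ _ → ∀-⇔ λ _ → ∀-⇔ λ _ →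
      →-cong-⇔ (Image-sat ρe≗E ρw≗W refl refl) (→-cong-⇔ (Image-sat ρe≗E ρw≗W refl refl) (≐-sat refl refl))

    ImagesRespect-∑·-sat : Sat L (ImagesRespect-∑·ᶠ e w) ρ ⇔ ImagesRespect-∑· E W
    ImagesRespect-∑·-sat = ∀ⁿ-⇔ λ z → ∀ⁿ-⇔ λ z′ → ∀ⁿ-⇔ λ t → ∀ⁿ-⇔ λ t′ →
      let E₄ = wk-lookup t′ (wk-lookup t (wk-lookup z′ (wk-lookup z ρe≗E)))
          W₄ = wk-lookup t′ (wk-lookup t (wk-lookup z′ (wk-lookup z ρw≗W)))
          Z  = wk-lookup t′ (wk-lookup t (wk-lookup z′ (new-lookup z ρ)))
          Z′ = wk-lookup t′ (wk-lookup t (new-lookup z′ (z ++ ρ)))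
          T  = wk-lookup t′ (new-lookup t (z′ ++ (z ++ ρ)))
          T′ = new-lookup t′ (t ++ (z′ ++ (z ++ ρ)))
      in →-cong-⇔ (Images-sat E₄ W₄ Z T) (→-cong-⇔ (Images-sat E₄ W₄ Z′ T′)
           (→-cong-⇔ (≐-sat (∑·ᵗ-eval E₄ Z) (∑·ᵗ-eval E₄ Z′)) (≐-sat (∑·ᵗ-eval E₄ T) (∑·ᵗ-eval E₄ T′))))

    ImagesRespect-·-sat : Sat L (ImagesRespect-·ᶠ e w) ρ ⇔ ImagesRespect-· E W
    ImagesRespect-·-sat = ∀-⇔ λ x → ∀-⇔ λ y → ∀-⇔ λ s → ∀ⁿ-⇔ λ z → ∀ⁿ-⇔ λ t →
      let ρ₀ = s ∷ y ∷ x ∷ ρ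
          E₂ = wk-lookup t (wk-lookup z ρe≗E)
          W₂ = wk-lookup t (wk-lookup z ρw≗W)
          Z  = wk-lookup t (new-lookup z ρ₀)
          T  = new-lookup t (z ++ ρ₀)
          lookup₀ : ∀ i → (t ++ (z ++ ρ₀)) (n ↑ʳ (n ↑ʳ i)) ≡ ρ₀ i
          lookup₀ i = trans (lookup-++ʳ t _ _) (lookup-++ʳ z ρ₀ i)
      in →-cong-⇔ (Image-sat E₂ W₂ (lookup₀ 1F) (lookup₀ 0F)) (→-cong-⇔ (Images-sat E₂ W₂ Z T)
           (→-cong-⇔ (≐-sat (cong₂ _·_ (lookup₀ 2F) (lookup₀ 1F)) (∑·ᵗ-eval E₂ Z))
                     (≐-sat (cong₂ _·_ (lookup₀ 2F) (lookup₀ 0F)) (∑·ᵗ-eval E₂ T))))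

    IsScalarCode-sat : Sat L (IsScalarCodeᶠ e w) ρ ⇔ IsScalarCode E W
    IsScalarCode-sat = fields⇔record ⇔-∘
      (Faithful-sat ×-⇔ SpansSquare-sat ×-⇔ HasImages-sat ×-⇔ Balanced-sat ×-⇔
       ImagesRespect-∑·-sat ×-⇔ ImagesRespect-·-sat)
      where
      fields⇔record : (Faithful E × SpansSquare E × HasImages E W × Balanced E W ×
                       ImagesRespect-∑· E W × ImagesRespect-· E W) ⇔ IsScalarCode E W
      fields⇔record = mk⇔
        (λ (f , s , h , b , r , r′) → record
          { faithful = f ; spans = s ; hasImages = h ; balanced = b ; respects-∑· = r ; respects-· = r′ })
        (λ c → let open IsScalarCode c in faithful , spans , hasImages , balanced , respects-∑· , respects-·)

    IsZeroP-sat : Sat L (IsZeroPᶠ e w) ρ ⇔ (∀ x s → Image E W x s → s ≋ 0ᴹ)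
    IsZeroP-sat = ∀-⇔ λ _ → ∀-⇔ λ _ →
      →-cong-⇔ (Image-sat ρe≗E ρw≗W refl refl) (∀-⇔ λ _ → ≐-sat refl refl)

    IsOneP-sat : Sat L (IsOnePᶠ e w) ρ ⇔ (∀ x s → Image E W x s → s ≋ x)
    IsOneP-sat = ∀-⇔ λ _ → ∀-⇔ λ _ →
      →-cong-⇔ (Image-sat ρe≗E ρw≗W refl refl) (∀-⇔ λ _ → ≐-sat refl refl)

    Actᴹ-sat : ∀ {x y X Y} → ρ x ≡ X → ρ y ≡ Y →
               Sat L (Actᴹᶠ e w x y) ρ ⇔ (∀ s → Image E W X s → s ≋ Y)
    Actᴹ-sat ρx≡X ρy≡Y = ∀-⇔ λ _ →
      →-cong-⇔ (Image-sat ρe≗E ρw≗W ρx≡X refl) (∀-⇔ λ z → ≐-sat refl (cong (_· z) ρy≡Y))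

    Actᴺ-sat : ∀ {xs ys xs′ ys′ X Y X′ Y′} → ρ ∘ xs ≗ X → ρ ∘ ys ≗ Y → ρ ∘ xs′ ≗ X′ → ρ ∘ ys′ ≗ Y′ →
               Sat L (Actᴺᶠ e w xs ys xs′ ys′) ρ ⇔ (∀ t → Images E W Y t → ∑· X t ≈ᴹ ∑· X′ Y′)
    Actᴺ-sat ρxs≗X ρys≗Y ρxs′≗X′ ρys′≗Y′ = ∀ⁿ-⇔ λ t →
      →-cong-⇔ (Images-sat (wk-lookup t ρe≗E) (wk-lookup t ρw≗W) (wk-lookup t ρys≗Y) (new-lookup t ρ))
               (≐-sat (∑·ᵗ-eval (wk-lookup t ρxs≗X) (new-lookup t ρ))
                      (∑·ᵗ-eval (wk-lookup t ρxs′≗X′) (wk-lookup t ρys′≗Y′)))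

    module _ {e′ w′ : Fin n → Fin k} {E′ W′ : V} (ρe′≗E′ : ρ ∘ e′ ≗ E′) (ρw′≗W′ : ρ ∘ w′ ≗ W′) where

      ≈P-sat : Sat L (≈Pᶠ e w e′ w′) ρ ⇔ (∀ x s s′ → Image E W x s → Image E′ W′ x s′ → s ≋ s′)
      ≈P-sat = ∀-⇔ λ _ → ∀-⇔ λ _ → ∀-⇔ λ _ →
        →-cong-⇔ (Image-sat ρe≗E ρw≗W refl refl)
                 (→-cong-⇔ (Image-sat ρe′≗E′ ρw′≗W′ refl refl) (∀-⇔ λ _ → ≐-sat refl refl))

      module _ {e″ w″ : Fin n → Fin k} {E″ W″ : V} (ρe″≗E″ : ρ ∘ e″ ≗ E″) (ρw″≗W″ : ρ ∘ w″ ≗ W″) where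

        IsSumP-sat : Sat L (IsSumPᶠ e w e′ w′ e″ w″) ρ ⇔
                     (∀ x a b s → Image E W x a → Image E′ W′ x b → Image E″ W″ x s → s ≋ a +ᴹ b)
        IsSumP-sat = ∀-⇔ λ _ → ∀-⇔ λ _ → ∀-⇔ λ _ → ∀-⇔ λ _ →
          →-cong-⇔ (Image-sat ρe≗E ρw≗W refl refl) (→-cong-⇔ (Image-sat ρe′≗E′ ρw′≗W′ refl refl)
            (→-cong-⇔ (Image-sat ρe″≗E″ ρw″≗W″ refl refl) (∀-⇔ λ _ → ≐-sat refl refl)))

        IsProdP-sat : Sat L (IsProdPᶠ e w e′ w′ e″ w″) ρ ⇔
                      (∀ x a b s → Image E′ W′ x a → Image E W a b → Image E″ W″ x s → s ≋ b)
        IsProdP-sat = ∀-⇔ λ _ → ∀-⇔ λ _ → ∀-⇔ λ _ → ∀-⇔ λ _ →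
          →-cong-⇔ (Image-sat ρe′≗E′ ρw′≗W′ refl refl) (→-cong-⇔ (Image-sat ρe≗E ρw≗W refl refl)
            (→-cong-⇔ (Image-sat ρe″≗E″ ρw″≗W″ refl refl) (∀-⇔ λ _ → ≐-sat refl refl)))

module Interpretation (n : ℕ) where
  open Syntax n

  nP : ℕ
  nP = n + n

  -- A pair (E , W) of n-tuples is coded by the 2n-tuple E ++ W.
  fstᵖ sndᵖ : Fin n → Fin nP
  fstᵖ = _↑ˡ n
  sndᵖ = n ↑ʳ_

  left right : (Fin n → Fin nP) → Fin n → Fin (nP + nP)
  left  = ext nP
  right = wk nP

  first second third : (Fin n → Fin nP) → Fin n → Fin (nP + (nP + nP))
  first  = ext (nP + nP)
  second = wk nP ∘ ext nP
  third  = wk nP ∘ wk nP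

  formulas : Formulas
  formulas = record
    { nP    = nP
    ; DomP  = IsScalarCodeᶠ fstᵖ sndᵖ
    ; EqP   = ≈Pᶠ (left fstᵖ) (left sndᵖ) (right fstᵖ) (right sndᵖ)
    ; ZeroP = IsZeroPᶠ fstᵖ sndᵖ
    ; OneP  = IsOnePᶠ fstᵖ sndᵖ
    ; AddP  = IsSumPᶠ (first fstᵖ) (first sndᵖ) (second fstᵖ) (second sndᵖ) (third fstᵖ) (third sndᵖ)
    ; MulP  = IsProdPᶠ (first fstᵖ) (first sndᵖ) (second fstᵖ) (second sndᵖ) (third fstᵖ) (third sndᵖ)
    ; nM    = 1
    ; DomM  = ⊤f
    ; EqM   = ∀f (var 1F ⊗ var 0F ≐ var 2F ⊗ var 0F)
    ; ZeroM = ∀f (var 1F ⊗ var 0F ≐ zer ⊗ var 0F)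
    ; AddM  = ∀f ((var 1F ⊕ var 2F) ⊗ var 0F ≐ var 3F ⊗ var 0F)
    ; ActM  = Actᴹᶠ (ext 2 fstᵖ) (ext 2 sndᵖ) (nP ↑ʳ 0F) (nP ↑ʳ 1F)
    ; nN    = nP
    ; DomN  = ⊤f
    ; EqN   = ∑·ᵗ (left fstᵖ) (left sndᵖ) ≐ ∑·ᵗ (right fstᵖ) (right sndᵖ)
    ; ZeroN = ∑·ᵗ fstᵖ sndᵖ ≐ zer
    ; AddN  = ∑·ᵗ (first fstᵖ) (first sndᵖ) ⊕ ∑·ᵗ (second fstᵖ) (second sndᵖ) ≐ ∑·ᵗ (third fstᵖ) (third sndᵖ)
    ; ActN  = Actᴺᶠ (first fstᵖ) (first sndᵖ) (second fstᵖ) (second sndᵖ) (third fstᵖ) (third sndᵖ)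
    }

  module _ {r ℓr m ℓm} {R : CommutativeRing r ℓr} (L : LieAlgebra R m ℓm)
           (g : Fin n → LieAlgebra.Carrierᴹ L) (generates : Generates L g) where
    open LieAlgebra L
    open Semantics L
    open LieFacts L
    open ScalarCodes L
    open Generators L g generates
    open Satisfaction L n
    open Equivalence
    open import Algebra.Properties.CommutativeMonoid.Sum +ᴹ-commutativeMonoid using (sum-cong-≗)

    left-lookup : ∀ (a b : Env nP) p → (a ++ b) ∘ left p ≗ a ∘ p
    left-lookup a b p = lookup-++ˡ a b ∘ p

    right-lookup : ∀ (a b : Env nP) p → (a ++ b) ∘ right p ≗ b ∘ p
    right-lookup a b p = wk-lookup a (λ _ → refl)

    first-lookup : ∀ (a b c : Env nP) p → (a ++ (b ++ c)) ∘ first p ≗ a ∘ p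
    first-lookup a b c p = lookup-++ˡ a (b ++ c) ∘ p

    second-lookup : ∀ (a b c : Env nP) p → (a ++ (b ++ c)) ∘ second p ≗ b ∘ p
    second-lookup a b c p = wk-lookup a (left-lookup b c p)

    third-lookup : ∀ (a b c : Env nP) p → (a ++ (b ++ c)) ∘ third p ≗ c ∘ p
    third-lookup a b c p = wk-lookup a (right-lookup b c p)

    code : (a : Env nP) → Sat L (IsScalarCodeᶠ fstᵖ sndᵖ) a → IsScalarCode (a ∘ fstᵖ) (a ∘ sndᵖ)
    code a = to (IsScalarCode-sat (λ _ → refl) (λ _ → refl))

    πP : (a : Env nP) → Sat L (IsScalarCodeᶠ fstᵖ sndᵖ) a → Scalar L
    πP a d = decode (code a d)

    πN : (a : Env nP) → Sat L ⊤f a → Sq L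
    πN a _ = ∑· (a ∘ fstᵖ) (a ∘ sndᵖ) , ∑·-InSq (a ∘ fstᵖ) (a ∘ sndᵖ)

    πP-onto : ∀ p → Σ (Env nP) λ a → Σ (Sat L (IsScalarCodeᶠ fstᵖ sndᵖ) a) λ d → _≈P_ L (πP a d) p
    πP-onto p = a , d , Decode.≈P-scalar (code a d) p
        (λ x → ≋-sym (Decode.α-unique (code a d) (Image-resp-≗ (sym ∘ ae≗g) (sym ∘ aw≗α₂g) (scalar-image p x))))
      where
      a : Env nP
      a = g ++ (α₂ p ∘ g)
      ae≗g : a ∘ fstᵖ ≗ g
      ae≗g = lookup-++ˡ g _
      aw≗α₂g : a ∘ sndᵖ ≗ α₂ p ∘ g
      aw≗α₂g = lookup-++ʳ g _
      d : Sat L (IsScalarCodeᶠ fstᵖ sndᵖ) a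
      d = from (IsScalarCode-sat ae≗g aw≗α₂g) (scalar-code p)

    πN-onto : ∀ u → Σ (Env nP) λ a → Σ (Sat L ⊤f a) λ d → _≈Sq_ L (πN a d) u
    πN-onto (u , p) = a , (λ ⊥ → ⊥) , ≈ᴹ-trans (≈ᴹ-reflexive (sum-cong-≗ λ i → cong₂ _·_ (lookup-++ˡ g k i) (lookup-++ʳ g k i)))
                                                (≈ᴹ-sym (coeffs-spec generators-span p))
      where
      k = coeffs generators-span p
      a : Env nP
      a = g ++ k

    interprets : Interprets formulas L
    interprets = record
      { πP = πP
      ; πM = λ a _ → a 0F
      ; πN = πN
      ; πP-onto = πP-onto
      ; πM-onto = λ x → (λ _ → x) , (λ ⊥ → ⊥) , to ≋⇔~ ≋-refl
      ; πN-onto = πN-onto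
      ; EqP-ker = λ a b da db → ≈P-decode⇔ (code a da) (code b db) ⇔-∘
          ≈P-sat (left-lookup a b fstᵖ) (left-lookup a b sndᵖ) (right-lookup a b fstᵖ) (right-lookup a b sndᵖ)
      ; ZeroP-ok = λ a da → IsZeroP-decode⇔ (code a da) ⇔-∘ IsZeroP-sat (λ _ → refl) (λ _ → refl)
      ; OneP-ok  = λ a da → IsOneP-decode⇔ (code a da) ⇔-∘ IsOneP-sat (λ _ → refl) (λ _ → refl)
      ; AddP-ok  = λ a b c da db dc → IsSumP-decode⇔ (code a da) (code b db) (code c dc) ⇔-∘
          IsSumP-sat (first-lookup a b c fstᵖ) (first-lookup a b c sndᵖ) (second-lookup a b c fstᵖ)
                     (second-lookup a b c sndᵖ) (third-lookup a b c fstᵖ) (third-lookup a b c sndᵖ)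
      ; MulP-ok  = λ a b c da db dc → IsProdP-decode⇔ (code a da) (code b db) (code c dc) ⇔-∘
          IsProdP-sat (first-lookup a b c fstᵖ) (first-lookup a b c sndᵖ) (second-lookup a b c fstᵖ)
                      (second-lookup a b c sndᵖ) (third-lookup a b c fstᵖ) (third-lookup a b c sndᵖ)
      ; EqM-ker  = λ _ _ _ _ → ≋⇔~ ⇔-∘ ∀-⇔ λ _ → ≐-sat refl refl
      ; ZeroM-ok = λ _ _ → ≋⇔~ ⇔-∘ ∀-⇔ λ _ → ≐-sat refl refl
      ; AddM-ok  = λ _ _ _ _ _ _ → ≋⇔~ ⇔-∘ ∀-⇔ λ _ → ≐-sat refl refl
      ; ActM-ok  = λ p a b dp _ _ → α₁-decode⇔ (code p dp) ⇔-∘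
          Actᴹ-sat (lookup-++ˡ p (a ++ b) ∘ fstᵖ) (lookup-++ˡ p (a ++ b) ∘ sndᵖ)
                   (lookup-++ʳ p (a ++ b) 0F) (lookup-++ʳ p (a ++ b) 1F)
      ; EqN-ker  = λ a b _ _ → ≐-sat (∑·ᵗ-eval (left-lookup a b fstᵖ) (left-lookup a b sndᵖ))
                                     (∑·ᵗ-eval (right-lookup a b fstᵖ) (right-lookup a b sndᵖ))
      ; ZeroN-ok = λ _ _ → ≐-sat (∑·ᵗ-eval (λ _ → refl) (λ _ → refl)) refl
      ; AddN-ok  = λ a b c _ _ _ → ≐-sat
          (cong₂ _+ᴹ_ (∑·ᵗ-eval (first-lookup a b c fstᵖ) (first-lookup a b c sndᵖ))
                      (∑·ᵗ-eval (second-lookup a b c fstᵖ) (second-lookup a b c sndᵖ)))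
          (∑·ᵗ-eval (third-lookup a b c fstᵖ) (third-lookup a b c sndᵖ))
      ; ActN-ok  = λ p a b dp _ _ → σ-decode⇔ (code p dp) (a ∘ fstᵖ) (a ∘ sndᵖ) (b ∘ fstᵖ) (b ∘ sndᵖ) ⇔-∘
          Actᴺ-sat (first-lookup p a b fstᵖ) (first-lookup p a b sndᵖ) (second-lookup p a b fstᵖ)
                   (second-lookup p a b sndᵖ) (third-lookup p a b fstᵖ) (third-lookup p a b sndᵖ)
      }

theorem2p3 : {r ℓr m ℓm : Level} → (n : ℕ) →
    Σ Formulas λ F →
      (R : CommutativeRing r ℓr) → IsIntegralDomain R →
      (L : LieAlgebra R m ℓm) →
      (g : Fin n → LieAlgebra.Carrierᴹ L) → Generates L g →
      ExcludedMiddle (r ⊔ ℓr ⊔ m ⊔ ℓm) →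
      Interprets F L
theorem2p3 n = formulas , λ R _ L g generates _ → interprets L g generates
  where open Interpretation n
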